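{- Let $S,S'\subseteq\mathbb{N}$ be infinite sets. Suppose there are $S_0\subseteq S$ and $S'_0\subseteq S'$ such that $S\setminus S_0$ and $S'\setminus S'_0$ are finite and there is a strictly increasing bi-Lipschitz bijection $f\colon S_0\to S'_0$. Then $S$ is loose if and only if $S'$ is loose.
   Context: A map $f\colon S_0\to S'_0$ between subsets of $\mathbb{N}$ is $\eta$-bi-Lipschitz ($\eta\ge1$) if $\eta^{ -1}|m-n|\le|f(m)-f(n)|\le\eta|m-n|$ for all $m,n\in S_0$; it is bi-Lipschitz if it is $\eta$-bi-Lipschitz for some $\eta\ge 1$. For $S\subseteq\mathbb{N}$ and $m\in S$, $\delta_S(m)=m'-m$ where $m'$ is the least element of $S$ greater than $m$ ($\infty$ if none); for $n,t\in\mathbb{Z}_+$, $\gamma_S(n,t)=|\{m\in S:\delta_S(m)\ge t,\ m+t<n\}|$. For $\varepsilon>0$, $S$ is $\varepsilon$-loose relative to $n$ if there exists $t\in\mathbb{Z}_+$ with $t\gamma_S(n,t)\ge\varepsilon n$ and $n^\varepsilon\le t\le n^{1-\varepsilon}$. $S$ is loose if there is $\varepsilon>0$ such that for all but finitely many $n\in\mathbb{Z}_+$, $S$ is $\varepsilon$-loose relative to $n$. -}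

module Defs where

open import Data.Nat using (ℕ; zero; suc; _+_; _*_; _^_; _≤_; _<_; _<ᵇ_; ∣_-_∣)
open import Data.Bool using (Bool; true; false; _∧_; not)
open import Data.Product using (Σ; ∃; _×_)
open import Relation.Binary.PropositionalEquality using (_≡_)

Subset : Set
Subset = ℕ → Bool

_∈_ : ℕ → Subset → Set
m ∈ S = S m ≡ true

_⊆_ : Subset → Subset → Set
A ⊆ B = ∀ m → m ∈ A → m ∈ B

Infinite : Subset → Set
Infinite S = ∀ N → ∃ λ m → N ≤ m × m ∈ S

-- B ∖ A is finite (given A ⊆ B): beyond some bound every element of B is in A.
CofiniteIn : Subset → Subset → Set
CofiniteIn A B = ∃ λ N → ∀ m → N ≤ m → m ∈ B → m ∈ A

noS : Subset → ℕ → ℕ → Bool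
noS S a zero    = true
noS S a (suc k) = not (S a) ∧ noS S (suc a) k

-- δ_S(m) ≥ t  (for t ≥ 1, m ∈ S): no element of S in the open interval (m, m+t),
-- i.e. the next element of S after m (if any) is at distance ≥ t (δ = ∞ allowed).
δ≥ : Subset → ℕ → ℕ → Bool
δ≥ S m zero    = true
δ≥ S m (suc t) = noS S (suc m) t

count : (ℕ → Bool) → ℕ → ℕ
count P zero    = 0
count P (suc n) = count P n + (if P n then 1 else 0)
  where open import Data.Bool using (if_then_else_)

γ : Subset → ℕ → ℕ → ℕ
γ S n t = count (λ m → S m ∧ δ≥ S m t ∧ (m + t <ᵇ n)) n

-- S is ε-loose relative to n, for ε = p / q (p, q ≥ 1), n ≥ 1:
--   ∃ t ≥ 1,  t γ_S(n,t) ≥ (p/q) n,  n^(p/q) ≤ t,  t ≤ n^(1 - p/q).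
-- Cleared of denominators / roots (valid for n ≥ 1, t ≥ 1):
--   p n ≤ q t γ,   n^p ≤ t^q,   t^q n^p ≤ n^q.
LooseRel : Subset → ℕ → ℕ → ℕ → Set
LooseRel S p q n = ∃ λ t → 1 ≤ t
  × p * n ≤ q * (t * γ S n t)
  × n ^ p ≤ t ^ q
  × t ^ q * n ^ p ≤ n ^ q

Loose : Subset → Set
Loose S = ∃ λ p → ∃ λ q → 1 ≤ p × 1 ≤ q
  × ∃ λ N → ∀ n → N ≤ n → 1 ≤ n → LooseRel S p q n

-- f : S₀ → S₀' is a strictly increasing bijection (f given as a function on ℕ,
-- only its values on S₀ matter).
StrictIncBij : Subset → Subset → (ℕ → ℕ) → Set
StrictIncBij S₀ S₀' f =
    (∀ m → m ∈ S₀ → f m ∈ S₀')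
  × (∀ m' → m' ∈ S₀' → ∃ λ m → m ∈ S₀ × f m ≡ m')
  × (∀ m n → m ∈ S₀ → n ∈ S₀ → m < n → f m < f n)

-- f is bi-Lipschitz on S₀ (constant η taken in ℕ; any real η can be rounded up).
BiLipschitz : Subset → (ℕ → ℕ) → Set
BiLipschitz S₀ f = ∃ λ η → 1 ≤ η × (∀ m n → m ∈ S₀ → n ∈ S₀ →
    ∣ m - n ∣ ≤ η * ∣ f m - f n ∣ × ∣ f m - f n ∣ ≤ η * ∣ m - n ∣)

-- Far out, S and S' agree with S₀ and S₀', and f distorts distances by at most a factor η.
-- Given a witness t for S at n = n' / 2η, take the witness t / η for S' at n': a gap of length
-- t after m ∈ S becomes a gap of length at least t / η after f m, so f maps the elements counted
-- by γ_S(n, t), apart from finitely many, injectively to elements counted by γ_S'(n', t / η).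
-- The exceptions are negligible because γ_S(n, t) grows with n, and all three inequalities
-- survive with ε replaced by ε / 16η². The inverse of f satisfies the same hypotheses.

module Submission where

open import Defs
open import Data.Nat using (ℕ)
open import Data.Product using (Σ; ∃; _×_)
open import Function.Bundles using (_⇔_)

open import Data.Bool using (Bool; true; false; _∧_)
open import Data.Bool.Properties using (T-≡; ∧-conicalˡ; ∧-conicalʳ; ¬-not)
open import Data.Nat using (zero; suc; z<s; _+_; _*_; _∸_; _^_; _≤_; _<_; _<ᵇ_; ∣_-_∣; z≤n; s≤s; NonZero; >-nonZero; >-nonZero⁻¹)
open import Data.Nat.DivMod using (_/_; _%_; m≡m%n+[m/n]*n; m%n<n; m/n*n≤m; m≥n⇒m/n>0; /-monoˡ-≤; m*n/n≡m)
open import Data.Nat.Properties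
open import Algebra.Properties.CommutativeSemigroup *-commutativeSemigroup using (interchange)
open import Data.Nat.Tactic.RingSolver using (solve-∀)
open import Data.Product using (_,_; proj₁; proj₂; swap)
open import Data.Sum using (inj₁; inj₂)
open import Function.Bundles using (mk⇔; Equivalence)
open import Relation.Binary.PropositionalEquality
open import Relation.Nullary using (¬_; yes; no; contradiction)

^-distribʳ-* : ∀ m n o → (m * n) ^ o ≡ m ^ o * n ^ o
^-distribʳ-* m n zero    = refl
^-distribʳ-* m n (suc o) = begin
  m * n * (m * n) ^ o      ≡⟨ cong (m * n *_) (^-distribʳ-* m n o) ⟩
  m * n * (m ^ o * n ^ o)  ≡⟨ interchange m n (m ^ o) (n ^ o) ⟩
  m * m ^ o * (n * n ^ o)  ∎
  where open ≡-Reasoning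

m≤m^n : ∀ m n .{{_ : NonZero n}} → m ≤ m ^ n
m≤m^n zero    (suc n) = z≤n
m≤m^n (suc m) (suc n) = m≤m*n (suc m) (suc m ^ n) {{m^n≢0 (suc m) n}}

^-cancelʳ-≤ : ∀ {m o} n .{{_ : NonZero n}} → m ^ n ≤ o ^ n → m ≤ o
^-cancelʳ-≤ n le = ≮⇒≥ (λ o<m → <⇒≱ (^-monoˡ-< n o<m) le)

^-cancelˡ-≤ : ∀ m {n o} → 1 < m → m ^ n ≤ m ^ o → n ≤ o
^-cancelˡ-≤ m 1<m le = ≮⇒≥ (λ o<n → <⇒≱ (^-monoʳ-< m 1<m o<n) le)

m*n+m*n≡2*m*n : ∀ m n → m * n + m * n ≡ 2 * m * n
m*n+m*n≡2*m*n = solve-∀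

m≤n+o⇒2*n≤m⇒m≤2*o : ∀ {m n o} → m ≤ n + o → 2 * n ≤ m → m ≤ 2 * o
m≤n+o⇒2*n≤m⇒m≤2*o {m} {n} {o} m≤n+o 2n≤m = +-cancelˡ-≤ m m (2 * o) (begin
  m + m              ≤⟨ +-mono-≤ m≤n+o m≤n+o ⟩
  (n + o) + (n + o)  ≡⟨ regroup n o ⟩
  2 * n + 2 * o      ≤⟨ +-monoˡ-≤ (2 * o) 2n≤m ⟩
  m + 2 * o          ∎)
  where
  open ≤-Reasoning
  regroup : ∀ n o → (n + o) + (n + o) ≡ 2 * n + 2 * o
  regroup = solve-∀

m+n≤o⇒m≤o×n≤o : ∀ {m n o} → m + n ≤ o → m ≤ o × n ≤ o
m+n≤o⇒m≤o×n≤o {m} m+n≤o = m+n≤o⇒m≤o m m+n≤o , m+n≤o⇒n≤o m m+n≤o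

n*[m/n]≤m : ∀ m n .{{_ : NonZero n}} → n * (m / n) ≤ m
n*[m/n]≤m m n = subst (_≤ m) (*-comm (m / n) n) (m/n*n≤m m n)

n≤m⇒m≤2*n*[m/n] : ∀ m n .{{_ : NonZero n}} → n ≤ m → m ≤ 2 * n * (m / n)
n≤m⇒m≤2*n*[m/n] m n n≤m = begin
  m                        ≡⟨ m≡m%n+[m/n]*n m n ⟩
  m % n + m / n * n        ≤⟨ +-monoˡ-≤ (m / n * n) (<⇒≤ (m%n<n m n)) ⟩
  n + m / n * n            ≤⟨ +-mono-≤ n≤n*[m/n] (≤-reflexive (*-comm (m / n) n)) ⟩
  n * (m / n) + n * (m / n) ≡⟨ m*n+m*n≡2*m*n n (m / n) ⟩
  2 * n * (m / n)          ∎
  where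
  open ≤-Reasoning
  n≤n*[m/n] : n ≤ n * (m / n)
  n≤n*[m/n] = m≤m*n n (m / n) {{>-nonZero (m≥n⇒m/n>0 n≤m)}}

-- Counting

count-≤ : ∀ P n → count P n ≤ n
count-≤ P zero = z≤n
count-≤ P (suc n) with P n
... | true  = ≤-trans (≤-reflexive (+-comm (count P n) 1)) (s≤s (count-≤ P n))
... | false = ≤-trans (≤-reflexive (+-identityʳ (count P n))) (m≤n⇒m≤1+n (count-≤ P n))

count-mono : ∀ P {m n} → m ≤ n → count P m ≤ count P n
count-mono P {n = zero} z≤n = ≤-refl
count-mono P {m} {suc n} m≤1+n with m≤n⇒m<n∨m≡n m≤1+n
... | inj₁ m<1+n = ≤-trans (count-mono P (≤-pred m<1+n)) (m≤m+n (count P n) _)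
... | inj₂ refl  = ≤-refl

count-hit : ∀ P {m n} → P m ≡ true → m < n → suc (count P m) ≤ count P n
count-hit P {m} Pm m<n = ≤-trans suc-count≤count[1+m] (count-mono P m<n)
  where
  suc-count≤count[1+m] : suc (count P m) ≤ count P (suc m)
  suc-count≤count[1+m] rewrite Pm = ≤-reflexive (+-comm 1 (count P m))

count-≤-image : ∀ (P Q : ℕ → Bool) (h : ℕ → ℕ) c →
  (∀ {m k} → c ≤ m → m < k → P m ≡ true → P k ≡ true → h m < h k) →
  ∀ n b → (∀ {m} → c ≤ m → m < n → P m ≡ true → Q (h m) ≡ true × h m < b) →
  count P n ≤ c + count Q b
count-≤-image P Q h c inc zero b maps = z≤n
count-≤-image P Q h c inc (suc n) b maps with c ≤? n
... | no n<c = ≤-trans (count-≤ P (suc n)) (≤-trans (≰⇒> n<c) (m≤m+n c _))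
... | yes c≤n with P n in Pn
...   | false = begin
  count P n + 0    ≡⟨ +-identityʳ (count P n) ⟩
  count P n        ≤⟨ count-≤-image P Q h c inc n b (λ c≤m m<n → maps c≤m (m<n⇒m<1+n m<n)) ⟩
  c + count Q b    ∎
  where open ≤-Reasoning
...   | true = begin
  count P n + 1              ≡⟨ +-comm (count P n) 1 ⟩
  suc (count P n)            ≤⟨ s≤s (count-≤-image P Q h c inc n (h n) maps<hn) ⟩
  suc (c + count Q (h n))    ≡⟨ sym (+-suc c _) ⟩
  c + suc (count Q (h n))    ≤⟨ +-monoʳ-≤ c (count-hit Q (proj₁ hn) (proj₂ hn)) ⟩
  c + count Q b              ∎
  where
  open ≤-Reasoning
  hn : Q (h n) ≡ true × h n < b
  hn = maps c≤n ≤-refl Pn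
  maps<hn : ∀ {m} → c ≤ m → m < n → P m ≡ true → Q (h m) ≡ true × h m < h n
  maps<hn c≤m m<n Pm = proj₁ (maps c≤m (m<n⇒m<1+n m<n) Pm) , inc c≤m m<n Pm Pn

-- Gaps

Gap : Subset → ℕ → ℕ → Set
Gap S m t = ∀ {j} → m < j → j < m + t → S j ≡ false

noS⇒∉ : ∀ S a k → noS S a k ≡ true → ∀ {j} → a ≤ j → j < a + k → S j ≡ false
noS⇒∉ S a zero    _ a≤j j<a+0 = contradiction (subst (_ <_) (+-identityʳ a) j<a+0) (≤⇒≯ a≤j)
noS⇒∉ S a (suc k) e {j} a≤j j<a+1+k with S a in Sa | m≤n⇒m<n∨m≡n a≤j
... | false | inj₂ refl = Sa
... | false | inj₁ a<j  = noS⇒∉ S (suc a) k e a<j (subst (j <_) (+-suc a k) j<a+1+k)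

∉⇒noS : ∀ S a k → (∀ {j} → a ≤ j → j < a + k → S j ≡ false) → noS S a k ≡ true
∉⇒noS S a zero    _ = refl
∉⇒noS S a (suc k) ∉ rewrite ∉ ≤-refl (m<m+n a z<s) =
  ∉⇒noS S (suc a) k (λ {j} a<j j<1+a+k → ∉ (<⇒≤ a<j) (subst (j <_) (sym (+-suc a k)) j<1+a+k))

δ≥⇔Gap : ∀ S m t → δ≥ S m t ≡ true ⇔ Gap S m t
δ≥⇔Gap S m zero = mk⇔ (λ _ {j} m<j j<m+0 → contradiction (subst (j <_) (+-identityʳ m) j<m+0) (<⇒≯ m<j))
                      (λ _ → refl)
δ≥⇔Gap S m (suc t) = mk⇔
  (λ e {j} m<j j<m+1+t → noS⇒∉ S (suc m) t e m<j (subst (j <_) (+-suc m t) j<m+1+t))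
  (λ gap → ∉⇒noS S (suc m) t (λ {j} m<j j<1+m+t → gap m<j (subst (j <_) (sym (+-suc m t)) j<1+m+t)))

counted? : Subset → ℕ → ℕ → ℕ → Bool
counted? S n t m = S m ∧ δ≥ S m t ∧ (m + t <ᵇ n)

Counted : Subset → ℕ → ℕ → ℕ → Set
Counted S n t m = m ∈ S × Gap S m t × m + t < n

counted⇔ : ∀ S n t m → counted? S n t m ≡ true ⇔ Counted S n t m
counted⇔ S n t m = mk⇔ to from
  where
  to : counted? S n t m ≡ true → Counted S n t m
  to e = ∧-conicalˡ (S m) _ e
       , Equivalence.to (δ≥⇔Gap S m t) (∧-conicalˡ (δ≥ S m t) _ gap∧<)
       , <ᵇ⇒< (m + t) n (Equivalence.from T-≡ (∧-conicalʳ (δ≥ S m t) _ gap∧<))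
    where
    gap∧< : δ≥ S m t ∧ (m + t <ᵇ n) ≡ true
    gap∧< = ∧-conicalʳ (S m) _ e
  from : Counted S n t m → counted? S n t m ≡ true
  from (m∈S , gap , m+t<n)
    rewrite m∈S | Equivalence.from (δ≥⇔Gap S m t) gap = Equivalence.to T-≡ (<⇒<ᵇ m+t<n)

γ-≤-image : ∀ {S S' n n' t t'} (h : ℕ → ℕ) c →
  (∀ {m k} → c ≤ m → m < k → Counted S n t m → Counted S n t k → h m < h k) →
  (∀ {m} → c ≤ m → Counted S n t m → Counted S' n' t' (h m)) →
  γ S n t ≤ c + γ S' n' t'
γ-≤-image {S} {S'} {n} {n'} {t} {t'} h c inc maps =
  count-≤-image (counted? S n t) (counted? S' n' t') h c
    (λ c≤m m<k Pm Pk → inc c≤m m<k (to Pm) (to Pk)) n n' image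
  where
  to : ∀ {m} → counted? S n t m ≡ true → Counted S n t m
  to {m} = Equivalence.to (counted⇔ S n t m)
  image : ∀ {m} → c ≤ m → m < n → counted? S n t m ≡ true →
    counted? S' n' t' (h m) ≡ true × h m < n'
  image {m} c≤m _ Pm = Equivalence.from (counted⇔ S' n' t' (h m)) counted
                     , ≤-<-trans (m≤m+n (h m) t') (proj₂ (proj₂ counted))
    where
    counted : Counted S' n' t' (h m)
    counted = maps c≤m (to Pm)

-- Strictly increasing bi-Lipschitz bijections

StrictIncOn : Subset → (ℕ → ℕ) → Set
StrictIncOn S₀ f = ∀ m n → m ∈ S₀ → n ∈ S₀ → m < n → f m < f n

BiLipschitzWith : ℕ → Subset → (ℕ → ℕ) → Set
BiLipschitzWith η S₀ f = ∀ m n → m ∈ S₀ → n ∈ S₀ →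
  ∣ m - n ∣ ≤ η * ∣ f m - f n ∣ × ∣ f m - f n ∣ ≤ η * ∣ m - n ∣

module _ {S₀ : Subset} {f : ℕ → ℕ} (inc : StrictIncOn S₀ f) where

  strictInc⇒reflects-≤ : ∀ {m n} → m ∈ S₀ → n ∈ S₀ → f m ≤ f n → m ≤ n
  strictInc⇒reflects-≤ m∈S₀ n∈S₀ fm≤fn = ≮⇒≥ (λ n<m → <⇒≱ (inc _ _ n∈S₀ m∈S₀ n<m) fm≤fn)

  strictInc⇒injective : ∀ {m n} → m ∈ S₀ → n ∈ S₀ → f m ≡ f n → m ≡ n
  strictInc⇒injective m∈S₀ n∈S₀ fm≡fn = ≤-antisym
    (strictInc⇒reflects-≤ m∈S₀ n∈S₀ (≤-reflexive fm≡fn))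
    (strictInc⇒reflects-≤ n∈S₀ m∈S₀ (≤-reflexive (sym fm≡fn)))

  strictInc⇒reflects-< : ∀ {m n} → m ∈ S₀ → n ∈ S₀ → f m < f n → m < n
  strictInc⇒reflects-< m∈S₀ n∈S₀ fm<fn = ≤∧≢⇒<
    (strictInc⇒reflects-≤ m∈S₀ n∈S₀ (<⇒≤ fm<fn))
    (λ m≡n → <-irrefl (cong f m≡n) fm<fn)

  bilipschitz-< : ∀ {η m n} → BiLipschitzWith η S₀ f → m ∈ S₀ → n ∈ S₀ → m < n →
    n ∸ m ≤ η * (f n ∸ f m) × f n ∸ f m ≤ η * (n ∸ m)
  bilipschitz-< {η} lip m∈S₀ n∈S₀ m<n = subst₂ (λ d d' → d ≤ η * d' × d' ≤ η * d)
    (m≤n⇒∣m-n∣≡n∸m (<⇒≤ m<n)) (m≤n⇒∣m-n∣≡n∸m (<⇒≤ (inc _ _ m∈S₀ n∈S₀ m<n)))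
    (lip _ _ m∈S₀ n∈S₀)

module Inverse {S₀ S₀' : Subset} {f : ℕ → ℕ} (bij : StrictIncBij S₀ S₀' f) where

  private
    f∈S₀' : ∀ m → m ∈ S₀ → f m ∈ S₀'
    f∈S₀' = proj₁ bij
    surj : ∀ m' → m' ∈ S₀' → ∃ λ m → m ∈ S₀ × f m ≡ m'
    surj = proj₁ (proj₂ bij)
    inc : StrictIncOn S₀ f
    inc = proj₂ (proj₂ bij)

    choose : ∀ m' b → S₀' m' ≡ b → ℕ
    choose m' true  m'∈S₀' = proj₁ (surj m' m'∈S₀')
    choose m' false _      = 0

    choose-spec : ∀ m' b (e : S₀' m' ≡ b) → b ≡ true → choose m' b e ∈ S₀ × f (choose m' b e) ≡ m'
    choose-spec m' true m'∈S₀' _ = proj₂ (surj m' m'∈S₀')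

  f⁻¹ : ℕ → ℕ
  f⁻¹ m' = choose m' (S₀' m') refl

  f⁻¹-spec : ∀ {m'} → m' ∈ S₀' → f⁻¹ m' ∈ S₀ × f (f⁻¹ m') ≡ m'
  f⁻¹-spec {m'} = choose-spec m' (S₀' m') refl

  strictIncBij-inverse : StrictIncBij S₀' S₀ f⁻¹
  strictIncBij-inverse = (λ _ m'∈S₀' → proj₁ (f⁻¹-spec m'∈S₀'))
    , (λ m m∈S₀ → f m , f∈S₀' m m∈S₀ , f⁻¹∘f m∈S₀)
    , λ m' n' m'∈S₀' n'∈S₀' m'<n' → strictInc⇒reflects-< inc
        (proj₁ (f⁻¹-spec m'∈S₀')) (proj₁ (f⁻¹-spec n'∈S₀'))
        (subst₂ _<_ (sym (proj₂ (f⁻¹-spec m'∈S₀'))) (sym (proj₂ (f⁻¹-spec n'∈S₀'))) m'<n')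
    where
    f⁻¹∘f : ∀ {m} → m ∈ S₀ → f⁻¹ (f m) ≡ m
    f⁻¹∘f {m} m∈S₀ = strictInc⇒injective inc (proj₁ (f⁻¹-spec fm∈S₀')) m∈S₀ (proj₂ (f⁻¹-spec fm∈S₀'))
      where
      fm∈S₀' : f m ∈ S₀'
      fm∈S₀' = f∈S₀' m m∈S₀

  bilipschitz-inverse : ∀ {η} → BiLipschitzWith η S₀ f → BiLipschitzWith η S₀' f⁻¹
  bilipschitz-inverse {η} lip m' n' m'∈S₀' n'∈S₀' = swap (subst₂
    (λ x y → ∣ f⁻¹ m' - f⁻¹ n' ∣ ≤ η * ∣ x - y ∣ × ∣ x - y ∣ ≤ η * ∣ f⁻¹ m' - f⁻¹ n' ∣)
    (proj₂ (f⁻¹-spec m'∈S₀')) (proj₂ (f⁻¹-spec n'∈S₀'))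
    (lip _ _ (proj₁ (f⁻¹-spec m'∈S₀')) (proj₁ (f⁻¹-spec n'∈S₀'))))

-- The three looseness inequalities

Dense : ℕ → ℕ → ℕ → ℕ → ℕ → Set
Dense p q n t g = p * n ≤ q * (t * g)

LowerBound : ℕ → ℕ → ℕ → ℕ → Set
LowerBound p q n t = n ^ p ≤ t ^ q

UpperBound : ℕ → ℕ → ℕ → ℕ → Set
UpperBound p q n t = t ^ q * n ^ p ≤ n ^ q

-- LooseRel S p q n unfolds to ∃ λ t → LooseAt p q n t (γ S n t).
LooseAt : ℕ → ℕ → ℕ → ℕ → ℕ → Set
LooseAt p q n t g = 1 ≤ t × Dense p q n t g × LowerBound p q n t × UpperBound p q n t

UpperBound⇒p≤q : ∀ {p q n t} → 2 ≤ n → 1 ≤ t → UpperBound p q n t → p ≤ q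
UpperBound⇒p≤q {p} {q} {n} {t} 2≤n 1≤t upper = ^-cancelˡ-≤ n 2≤n
  (≤-trans (m≤n*m (n ^ p) (t ^ q) {{>-nonZero (m^n>0 t {{>-nonZero 1≤t}} q)}}) upper)

UpperBound⇒t≤n : ∀ {p q n t} .{{_ : NonZero q}} .{{_ : NonZero n}} → UpperBound p q n t → t ≤ n
UpperBound⇒t≤n {p} {q} {n} {t} upper =
  ^-cancelʳ-≤ q (≤-trans (m≤m*n (t ^ q) (n ^ p) {{m^n≢0 n p}}) upper)

UpperBound-mono : ∀ {p q n n' t t'} .{{_ : NonZero n}} → p ≤ q → n ≤ n' → t' ≤ t →
  UpperBound p q n t → UpperBound p q n' t'
UpperBound-mono {p} {q} {n} {n'} {t} {t'} p≤q n≤n' t'≤t upper = begin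
  t' ^ q * n' ^ p   ≤⟨ *-monoˡ-≤ (n' ^ p) (≤-trans (^-monoˡ-≤ q t'≤t) tᵍ≤nᵈ) ⟩
  n ^ d * n' ^ p    ≤⟨ *-monoˡ-≤ (n' ^ p) (^-monoˡ-≤ d n≤n') ⟩
  n' ^ d * n' ^ p   ≡⟨ sym (^-split n') ⟩
  n' ^ q            ∎
  where
  open ≤-Reasoning
  d : ℕ
  d = q ∸ p
  ^-split : ∀ m → m ^ q ≡ m ^ d * m ^ p
  ^-split m = trans (cong (m ^_) (sym (m∸n+n≡m p≤q))) (^-distribˡ-+-* m d p)
  tᵍ≤nᵈ : t ^ q ≤ n ^ d
  tᵍ≤nᵈ = *-cancelʳ-≤ (t ^ q) (n ^ d) (n ^ p) {{m^n≢0 n p}} (≤-trans upper (≤-reflexive (^-split n)))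

UpperBound-raise : ∀ {p q r n t} → t ≤ n → q ≤ r → UpperBound p q n t → UpperBound p r n t
UpperBound-raise {p} {q} {r} {n} {t} t≤n q≤r upper = begin
  t ^ r * n ^ p            ≡⟨ cong (_* n ^ p) (^-split t) ⟩
  t ^ e * t ^ q * n ^ p    ≡⟨ *-assoc (t ^ e) (t ^ q) (n ^ p) ⟩
  t ^ e * (t ^ q * n ^ p)  ≤⟨ *-mono-≤ (^-monoˡ-≤ e t≤n) upper ⟩
  n ^ e * n ^ q            ≡⟨ sym (^-split n) ⟩
  n ^ r                    ∎
  where
  open ≤-Reasoning
  e : ℕ
  e = r ∸ q
  ^-split : ∀ m → m ^ r ≡ m ^ e * m ^ q
  ^-split m = trans (cong (m ^_) (sym (m∸n+n≡m q≤r))) (^-distribˡ-+-* m e q)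

LooseAt⇒n≤t^q : ∀ {p q n t g} .{{_ : NonZero p}} → LooseAt p q n t g → n ≤ t ^ q
LooseAt⇒n≤t^q {p} {n = n} (_ , _ , lower , _) = ≤-trans (m≤m^n n p) lower

LooseAt⇒n≤[q*g]^q : ∀ {p q n t g} .{{_ : NonZero p}} .{{_ : NonZero n}} →
  LooseAt p q n t g → n ≤ (q * g) ^ q
LooseAt⇒n≤[q*g]^q {p} {q} {n} {t} {g} (1≤t , dense , _ , upper) =
  ≤-trans (m≤m^n n p) (*-cancelˡ-≤ (t ^ q) {{m^n≢0 t q}} (begin
    t ^ q * n ^ p        ≤⟨ upper ⟩
    n ^ q                ≤⟨ ^-monoˡ-≤ q n≤t*[q*g] ⟩
    (t * (q * g)) ^ q    ≡⟨ ^-distribʳ-* t (q * g) q ⟩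
    t ^ q * (q * g) ^ q  ∎))
  where
  open ≤-Reasoning
  instance
    t≢0 : NonZero t
    t≢0 = >-nonZero 1≤t
  n≤t*[q*g] : n ≤ t * (q * g)
  n≤t*[q*g] = ≤-trans (m≤n*m n p) (≤-trans dense (≤-reflexive (x∙yz≡y∙xz q t g)))
    where
    x∙yz≡y∙xz : ∀ x y z → x * (y * z) ≡ y * (x * z)
    x∙yz≡y∙xz = solve-∀

Dense-rescale : ∀ {p q n t g n' t' g'} a b → n' ≤ a * n → t ≤ b * t' → g ≤ 2 * g' →
  Dense p q n t g → Dense p (2 * a * b * q) n' t' g'
Dense-rescale {p} {q} {n} {t} {g} {n'} {t'} {g'} a b n'≤an t≤bt' g≤2g' dense = begin
  p * n'                          ≤⟨ *-monoʳ-≤ p n'≤an ⟩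
  p * (a * n)                     ≡⟨ x∙yz≡y∙xz p a n ⟩
  a * (p * n)                     ≤⟨ *-monoʳ-≤ a dense ⟩
  a * (q * (t * g))               ≤⟨ *-monoʳ-≤ a (*-monoʳ-≤ q (*-mono-≤ t≤bt' g≤2g')) ⟩
  a * (q * (b * t' * (2 * g')))   ≡⟨ regroup a b q t' g' ⟩
  2 * a * b * q * (t' * g')       ∎
  where
  open ≤-Reasoning
  x∙yz≡y∙xz : ∀ x y z → x * (y * z) ≡ y * (x * z)
  x∙yz≡y∙xz = solve-∀
  regroup : ∀ a b q t g → a * (q * (b * t * (2 * g))) ≡ 2 * a * b * q * (t * g)
  regroup = solve-∀

LowerBound-rescale : ∀ {p q n t n' t'} a b .{{_ : NonZero a}} .{{_ : NonZero b}} .{{_ : NonZero t'}} →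
  n' ≤ a * n → t ≤ b * t' → a ^ p * b ^ q ≤ t' ^ q →
  LowerBound p q n t → LowerBound p (2 * a * b * q) n' t'
LowerBound-rescale {p} {q} {n} {t} {n'} {t'} a b n'≤an t≤bt' aᵖbᵍ≤t'ᵍ lower = begin
  n' ^ p                     ≤⟨ ^-monoˡ-≤ p n'≤an ⟩
  (a * n) ^ p                ≡⟨ ^-distribʳ-* a n p ⟩
  a ^ p * n ^ p              ≤⟨ *-monoʳ-≤ (a ^ p) (≤-trans lower (^-monoˡ-≤ q t≤bt')) ⟩
  a ^ p * (b * t') ^ q       ≡⟨ cong (a ^ p *_) (^-distribʳ-* b t' q) ⟩
  a ^ p * (b ^ q * t' ^ q)   ≡⟨ sym (*-assoc (a ^ p) (b ^ q) (t' ^ q)) ⟩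
  a ^ p * b ^ q * t' ^ q     ≤⟨ *-monoˡ-≤ (t' ^ q) aᵖbᵍ≤t'ᵍ ⟩
  t' ^ q * t' ^ q            ≡⟨ sym (^-distribˡ-+-* t' q q) ⟩
  t' ^ (q + q)               ≤⟨ ^-monoʳ-≤ t' q+q≤2abq ⟩
  t' ^ (2 * a * b * q)       ∎
  where
  open ≤-Reasoning
  q+q≤2abq : q + q ≤ 2 * a * b * q
  q+q≤2abq = ≤-trans (≤-reflexive (cong (q +_) (sym (+-identityʳ q))))
    (*-monoˡ-≤ q (≤-trans (m≤m*n 2 a) (m≤m*n (2 * a) b)))

LooseAt-rescale : ∀ {p q n t g n' t' g'} a b .{{_ : NonZero a}} .{{_ : NonZero b}} .{{_ : NonZero p}} →
  2 ≤ n → n ≤ n' → n' ≤ a * n → 1 ≤ t' → t' ≤ t → t ≤ b * t' → g ≤ 2 * g' →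
  a ^ p * b ^ q ≤ t' ^ q → LooseAt p q n t g → LooseAt p (2 * a * b * q) n' t' g'
LooseAt-rescale {p} {q} {n} {t} {g} {n'} {t'} {g'} a b
  2≤n n≤n' n'≤an 1≤t' t'≤t t≤bt' g≤2g' aᵖbᵍ≤t'ᵍ (1≤t , dense , lower , upper) =
    1≤t'
  , Dense-rescale {p} {q} {n} {t} {g} {n'} {t'} {g'} a b n'≤an t≤bt' g≤2g' dense
  , LowerBound-rescale {p} {q} {n} {t} {n'} {t'} a b n'≤an t≤bt' aᵖbᵍ≤t'ᵍ lower
  , UpperBound-raise {p} t'≤n' q≤2abq (UpperBound-mono {p} {q} {n} {n'} {t} p≤q n≤n' t'≤t upper)
  where
  p≤q : p ≤ q
  p≤q = UpperBound⇒p≤q {p} {q} 2≤n 1≤t upper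
  instance
    n≢0 : NonZero n
    n≢0 = >-nonZero (≤-trans (s≤s z≤n) 2≤n)
    q≢0 : NonZero q
    q≢0 = >-nonZero (≤-trans (>-nonZero⁻¹ p) p≤q)
    t'≢0 : NonZero t'
    t'≢0 = >-nonZero 1≤t'
  t'≤n' : t' ≤ n'
  t'≤n' = ≤-trans t'≤t (≤-trans (UpperBound⇒t≤n {p} {q} upper) n≤n')
  q≤2abq : q ≤ 2 * a * b * q
  q≤2abq = m≤n*m q (2 * a * b) {{m*n≢0 (2 * a) b {{m*n≢0 2 a}}}}

-- Transferring looseness along f

module LooseTransfer
  {S S' S₀ S₀' : Subset} {f : ℕ → ℕ}
  (infinite : Infinite S) (S₀⊆S : S₀ ⊆ S) (S₀'⊆S' : S₀' ⊆ S')
  (N₀ : ℕ) (cofinite : ∀ m → N₀ ≤ m → m ∈ S → m ∈ S₀)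
  (N₀' : ℕ) (cofinite' : ∀ m → N₀' ≤ m → m ∈ S' → m ∈ S₀')
  (bij : StrictIncBij S₀ S₀' f)
  (η₀ : ℕ) (lip : BiLipschitzWith (suc η₀) S₀ f)
  where

  η : ℕ
  η = suc η₀

  private
    f∈S₀' : ∀ m → m ∈ S₀ → f m ∈ S₀'
    f∈S₀' = proj₁ bij
    surj : ∀ m' → m' ∈ S₀' → ∃ λ m → m ∈ S₀ × f m ≡ m'
    surj = proj₁ (proj₂ bij)
    inc : StrictIncOn S₀ f
    inc = proj₂ (proj₂ bij)
    lip-< : ∀ {m n} → m ∈ S₀ → n ∈ S₀ → m < n → n ∸ m ≤ η * (f n ∸ f m) × f n ∸ f m ≤ η * (n ∸ m)
    lip-< = bilipschitz-< inc {η} lip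

  a : ℕ
  a = proj₁ (infinite N₀)

  N₀≤a : N₀ ≤ a
  N₀≤a = proj₁ (proj₂ (infinite N₀))

  a∈S₀ : a ∈ S₀
  a∈S₀ = cofinite a N₀≤a (proj₂ (proj₂ (infinite N₀)))

  M₀ : ℕ
  M₀ = η * N₀' + suc a

  M₀≤m⇒a<m : ∀ {m} → M₀ ≤ m → a < m
  M₀≤m⇒a<m = m+n≤o⇒n≤o (η * N₀')

  M₀≤m⇒∈S₀ : ∀ {m} → M₀ ≤ m → m ∈ S → m ∈ S₀
  M₀≤m⇒∈S₀ M₀≤m = cofinite _ (≤-trans N₀≤a (<⇒≤ (M₀≤m⇒a<m M₀≤m)))

  f[m]≤f[a]+η*m : ∀ {m} → M₀ ≤ m → m ∈ S₀ → f m ≤ f a + η * m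
  f[m]≤f[a]+η*m {m} M₀≤m m∈S₀ = begin
    f m                ≡⟨ sym (m+[n∸m]≡n (<⇒≤ (inc a m a∈S₀ m∈S₀ a<m))) ⟩
    f a + (f m ∸ f a)  ≤⟨ +-monoʳ-≤ (f a) (proj₂ (lip-< a∈S₀ m∈S₀ a<m)) ⟩
    f a + η * (m ∸ a)  ≤⟨ +-monoʳ-≤ (f a) (*-monoʳ-≤ η (m∸n≤m m a)) ⟩
    f a + η * m        ∎
    where
    open ≤-Reasoning
    a<m : a < m
    a<m = M₀≤m⇒a<m M₀≤m

  N₀'≤f[m] : ∀ {m} → M₀ ≤ m → m ∈ S₀ → N₀' ≤ f m
  N₀'≤f[m] {m} M₀≤m m∈S₀ = *-cancelˡ-≤ η (begin
    η * N₀'          ≤⟨ m+n≤o⇒m≤o∸n (η * N₀') M₀≤m ⟩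
    m ∸ suc a        ≤⟨ ∸-monoʳ-≤ m (n≤1+n a) ⟩
    m ∸ a            ≤⟨ proj₁ (lip-< a∈S₀ m∈S₀ (M₀≤m⇒a<m M₀≤m)) ⟩
    η * (f m ∸ f a)  ≤⟨ *-monoʳ-≤ η (m∸n≤m (f m) (f a)) ⟩
    η * f m          ∎)
    where open ≤-Reasoning

  gap-transfer : ∀ {m t t'} → M₀ ≤ m → m ∈ S₀ → η * t' ≤ t → Gap S m t → Gap S' (f m) t'
  gap-transfer {m} {t} {t'} M₀≤m m∈S₀ ηt'≤t gap {j} fm<j j<fm+t' = ¬-not j∉S'
    where
    -- j = f k with k ∈ S past the gap after m, so t ≤ k ∸ m ≤ η (j ∸ f m) < η t'.
    j∉S' : ¬ j ∈ S'
    j∉S' j∈S' = <-irrefl refl (begin-strict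
      t                ≤⟨ t≤k∸m ⟩
      k ∸ m            ≤⟨ proj₁ (lip-< m∈S₀ k∈S₀ m<k) ⟩
      η * (f k ∸ f m)  ≡⟨ cong (λ x → η * (x ∸ f m)) fk≡j ⟩
      η * (j ∸ f m)    <⟨ *-monoʳ-< η j∸fm<t' ⟩
      η * t'           ≤⟨ ηt'≤t ⟩
      t                ∎)
      where
      open ≤-Reasoning
      preimage : ∃ λ k → k ∈ S₀ × f k ≡ j
      preimage = surj j (cofinite' j (≤-trans (N₀'≤f[m] M₀≤m m∈S₀) (<⇒≤ fm<j)) j∈S')
      k : ℕ
      k = proj₁ preimage
      k∈S₀ : k ∈ S₀
      k∈S₀ = proj₁ (proj₂ preimage)
      fk≡j : f k ≡ j
      fk≡j = proj₂ (proj₂ preimage)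
      m<k : m < k
      m<k = strictInc⇒reflects-< inc m∈S₀ k∈S₀ (subst (f m <_) (sym fk≡j) fm<j)
      m+t≤k : m + t ≤ k
      m+t≤k = ≮⇒≥ (λ k<m+t → contradiction (trans (sym (S₀⊆S k k∈S₀)) (gap m<k k<m+t)) λ ())
      t≤k∸m : t ≤ k ∸ m
      t≤k∸m = subst (_≤ k ∸ m) (m+n∸m≡n m t) (∸-monoˡ-≤ m m+t≤k)
      j∸fm<t' : j ∸ f m < t'
      j∸fm<t' = +-cancelˡ-< (f m) (j ∸ f m) t'
        (subst (_< f m + t') (sym (m+[n∸m]≡n (<⇒≤ fm<j))) j<fm+t')

  γ-transfer : ∀ {n n' t t'} → η * t' ≤ t → f a + η * n ≤ n' → γ S n t ≤ M₀ + γ S' n' t'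
  γ-transfer {n} {n'} {t} {t'} ηt'≤t fa+ηn≤n' = γ-≤-image f M₀
    (λ M₀≤m m<k (m∈S , _) (k∈S , _) →
      inc _ _ (M₀≤m⇒∈S₀ M₀≤m m∈S) (M₀≤m⇒∈S₀ (≤-trans M₀≤m (<⇒≤ m<k)) k∈S) m<k)
    counted-image
    where
    counted-image : ∀ {m} → M₀ ≤ m → Counted S n t m → Counted S' n' t' (f m)
    counted-image {m} M₀≤m (m∈S , gap , m+t<n) =
      S₀'⊆S' _ (f∈S₀' m m∈S₀) , gap-transfer M₀≤m m∈S₀ ηt'≤t gap , (begin-strict
        f m + t'              ≤⟨ +-mono-≤ (f[m]≤f[a]+η*m M₀≤m m∈S₀) (≤-trans t'≤t (m≤n*m t η)) ⟩
        f a + η * m + η * t   ≡⟨ +-assoc (f a) (η * m) (η * t) ⟩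
        f a + (η * m + η * t) ≡⟨ cong (f a +_) (sym (*-distribˡ-+ η m t)) ⟩
        f a + η * (m + t)     <⟨ +-monoʳ-< (f a) (*-monoʳ-< η m+t<n) ⟩
        f a + η * n           ≤⟨ fa+ηn≤n' ⟩
        n'                    ∎)
      where
      open ≤-Reasoning
      m∈S₀ : m ∈ S₀
      m∈S₀ = M₀≤m⇒∈S₀ M₀≤m m∈S
      t'≤t : t' ≤ t
      t'≤t = ≤-trans (m≤n*m t' η) ηt'≤t

  K : ℕ
  K = 2 * η

  exponent-factor : ℕ
  exponent-factor = 2 * (2 * K) * (2 * η)

  witness-bound : ℕ → ℕ → ℕ
  witness-bound p q = (2 * η) ^ q * ((2 * K) ^ p * (2 * η) ^ q)

  γ-bound : ℕ → ℕ
  γ-bound q = (q * (2 * M₀)) ^ q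

  γ-bound<n⇒2*M₀≤γ : ∀ {p q n t} .{{_ : NonZero p}} .{{_ : NonZero n}} →
    γ-bound q < n → LooseAt p q n t (γ S n t) → 2 * M₀ ≤ γ S n t
  γ-bound<n⇒2*M₀≤γ {p} {q} {n} {t} γ-bound<n loose = ≮⇒≥ λ γ<2M₀ → <⇒≱ γ-bound<n
    (≤-trans (LooseAt⇒n≤[q*g]^q {p} {q} {n} {t} loose) (^-monoˡ-≤ q (*-monoʳ-≤ q (<⇒≤ γ<2M₀))))

  LooseAt-transfer : ∀ {p q n n' t} .{{_ : NonZero p}} .{{_ : NonZero q}} →
    2 ≤ n → f a ≤ n → η ^ q ≤ n → witness-bound p q ≤ n → γ-bound q < n →
    K * n ≤ n' → n' ≤ 2 * K * n →
    LooseAt p q n t (γ S n t) → LooseAt p (exponent-factor * q) n' (t / η) (γ S' n' (t / η))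
  LooseAt-transfer {p} {q} {n} {n'} {t} 2≤n fa≤n ηᵍ≤n witness-bound≤n γ-bound<n Kn≤n' n'≤2Kn loose =
    LooseAt-rescale {p} {q} {n} {t} {γ S n t} {n'} {t'} {γ S' n' t'} (2 * K) (2 * η)
      2≤n n≤n' n'≤2Kn 1≤t' t'≤t t≤2ηt' γ≤2γ' aᵖbᵍ≤t'ᵍ loose
    where
    open ≤-Reasoning
    instance
      n≢0 : NonZero n
      n≢0 = >-nonZero (≤-trans (s≤s z≤n) 2≤n)
    t' : ℕ
    t' = t / η
    n≤tᵍ : n ≤ t ^ q
    n≤tᵍ = LooseAt⇒n≤t^q {p} {q} {n} {t} {γ S n t} loose
    η≤t : η ≤ t
    η≤t = ^-cancelʳ-≤ q (≤-trans ηᵍ≤n n≤tᵍ)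
    1≤t' : 1 ≤ t'
    1≤t' = m≥n⇒m/n>0 η≤t
    ηt'≤t : η * t' ≤ t
    ηt'≤t = n*[m/n]≤m t η
    t'≤t : t' ≤ t
    t'≤t = ≤-trans (m≤n*m t' η) ηt'≤t
    t≤2ηt' : t ≤ 2 * η * t'
    t≤2ηt' = n≤m⇒m≤2*n*[m/n] t η η≤t
    n≤n' : n ≤ n'
    n≤n' = ≤-trans (m≤n*m n K) Kn≤n'
    aᵖbᵍ≤t'ᵍ : (2 * K) ^ p * (2 * η) ^ q ≤ t' ^ q
    aᵖbᵍ≤t'ᵍ = *-cancelˡ-≤ ((2 * η) ^ q) {{m^n≢0 (2 * η) q}} (begin
      witness-bound p q     ≤⟨ witness-bound≤n ⟩
      n                     ≤⟨ n≤tᵍ ⟩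
      t ^ q                 ≤⟨ ^-monoˡ-≤ q t≤2ηt' ⟩
      (2 * η * t') ^ q      ≡⟨ ^-distribʳ-* (2 * η) t' q ⟩
      (2 * η) ^ q * t' ^ q  ∎)
    fa+ηn≤n' : f a + η * n ≤ n'
    fa+ηn≤n' = begin
      f a + η * n    ≤⟨ +-monoˡ-≤ (η * n) (≤-trans fa≤n (m≤n*m n η)) ⟩
      η * n + η * n  ≡⟨ m*n+m*n≡2*m*n η n ⟩
      K * n          ≤⟨ Kn≤n' ⟩
      n'             ∎
    -- The at most M₀ elements counted by γ S n t below M₀ are at most half of them.
    γ≤2γ' : γ S n t ≤ 2 * γ S' n' t'
    γ≤2γ' = m≤n+o⇒2*n≤m⇒m≤2*o {n = M₀} (γ-transfer {n} {n'} {t} {t'} ηt'≤t fa+ηn≤n')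
      (γ-bound<n⇒2*M₀≤γ {p} {q} {n} {t} γ-bound<n loose)

  threshold : ℕ → ℕ → ℕ → ℕ
  threshold p q N = N + 2 + f a + η ^ q + witness-bound p q + suc (γ-bound q)

  threshold≤⇒bounds : ∀ {p q N n} → threshold p q N ≤ n →
    N ≤ n × 2 ≤ n × f a ≤ n × η ^ q ≤ n × witness-bound p q ≤ n × γ-bound q < n
  threshold≤⇒bounds le =
    let (le₄ , γ<) = m+n≤o⇒m≤o×n≤o le
        (le₃ , w≤) = m+n≤o⇒m≤o×n≤o le₄
        (le₂ , η≤) = m+n≤o⇒m≤o×n≤o le₃
        (le₁ , a≤) = m+n≤o⇒m≤o×n≤o le₂
        (N≤ , 2≤)  = m+n≤o⇒m≤o×n≤o le₁
    in N≤ , 2≤ , a≤ , η≤ , w≤ , γ<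

  loose : Loose S → Loose S'
  loose (p , q , 1≤p , 1≤q , N , looseS) =
    p , exponent-factor * q , 1≤p , ≤-trans 1≤q (m≤n*m q exponent-factor) , threshold p q N * K ,
    looseS'
    where
    instance
      p≢0 : NonZero p
      p≢0 = >-nonZero 1≤p
      q≢0 : NonZero q
      q≢0 = >-nonZero 1≤q
    looseS' : ∀ n' → threshold p q N * K ≤ n' → 1 ≤ n' → LooseRel S' p (exponent-factor * q) n'
    looseS' n' threshold≤n' _
      with threshold≤⇒bounds {p} {q} {N} (subst (_≤ n' / K) (m*n/n≡m (threshold p q N) K) (/-monoˡ-≤ K threshold≤n'))
    ... | N≤n , 2≤n , fa≤n , ηᵍ≤n , witness-bound≤n , γ-bound<n =
      t / η , LooseAt-transfer {p} {q} {n} {n'} {t} 2≤n fa≤n ηᵍ≤n witness-bound≤n γ-bound<n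
        (n*[m/n]≤m n' K) (n≤m⇒m≤2*n*[m/n] n' K K≤n') looseAt
      where
      n : ℕ
      n = n' / K
      1≤n : 1 ≤ n
      1≤n = ≤-trans (s≤s z≤n) 2≤n
      K≤n' : K ≤ n'
      K≤n' = ≤-trans (m≤m*n K n {{>-nonZero 1≤n}}) (n*[m/n]≤m n' K)
      t : ℕ
      t = proj₁ (looseS n N≤n 1≤n)
      looseAt : LooseAt p q n t (γ S n t)
      looseAt = proj₂ (looseS n N≤n 1≤n)

proposition3p13 : (S S' : Subset) → Infinite S → Infinite S' →
    (S₀ S₀' : Subset) → S₀ ⊆ S → S₀' ⊆ S' → CofiniteIn S₀ S → CofiniteIn S₀' S' →
    (f : ℕ → ℕ) → StrictIncBij S₀ S₀' f → BiLipschitz S₀ f →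
    Loose S ⇔ Loose S'
proposition3p13 S S' infS infS' S₀ S₀' S₀⊆S S₀'⊆S' (N₀ , cof) (N₀' , cof') f bij (suc η₀ , _ , lip) =
  mk⇔ (LooseTransfer.loose infS S₀⊆S S₀'⊆S' N₀ cof N₀' cof' bij η₀ lip)
      (LooseTransfer.loose infS' S₀'⊆S' S₀⊆S N₀' cof' N₀ cof (strictIncBij-inverse bij) η₀
        (bilipschitz-inverse bij {suc η₀} lip))
  where open Inverse
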